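{- Let $S = \{(a_1,b_1),\dots,(a_r,b_r)\} \subset \mathbb{A}^2(\mathbb{Q})$ be an acceptable set with $r \ge 2$. Put $d = 18r+3$, $m = \prod_{1 \le j < k \le r}(a_j - a_k)$ and $N = \prod_{p \text{ prime},\, v_p(m)>0} p$. Let $h(X) \in \mathbb{Q}[X]$ be an irreducible polynomial of degree $6r+3$ with $h(a_i) = b_i^d$ for all $i$ and $m\cdot h(X) \in \mathbb{Z}[X]$. Let $\mathcal{B}\subset\mathbb{C}$ be finite, and let $\ell$ be a prime such that no zero of $g(X) := \ell N^6 \prod_{i=1}^r (X-a_i)^6 + 1$ lies in $\mathcal{B}$, $(h(X)-1)g(X)+1$ is separable, $\gcd(\ell,N)=1$ and $\ell \equiv 5 \pmod{12}$. Then the polynomial $$f_{S,\mathcal{B}}(X) = g(X)\big((h(X)-1)g(X)+1\big)$$ has no rational roots.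
   Context: A finite set $S = \{(a_1,b_1),\dots,(a_r,b_r)\} \subset \mathbb{A}^2(\mathbb{Q})$ of distinct rational points is called acceptable if (i) $a_i = a_j$ implies $b_i = b_j$ (so the $a_i$ are pairwise distinct), (ii) $a_i \neq 0$ and $b_j \neq 0$ for all $i,j$, and (iii) $a_i, b_j \in \mathbb{Z}$ for all $i,j$. The paper assumes throughout this part that $r = |S| \ge 2$. $v_p$ denotes the $p$-adic valuation. -}

module Defs where

open import Level using (Level)
open import Data.Nat as ℕ using (ℕ; zero; suc)
open import Data.Nat.Divisibility using (_∣?_)
open import Data.Nat.Primality using (prime?)
open import Data.Integer as ℤ using (ℤ)
open import Data.Rational as ℚ using (ℚ; 0ℚ; 1ℚ)
open import Data.Fin using (Fin; toℕ)
open import Data.Nat.ListAction using (product)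
open import Data.List using (List; []; _∷_; map; filter; foldr; upTo; allFin; concatMap; length)
open import Data.Product using (Σ; _×_; _,_; ∃)
open import Data.Sum using (_⊎_)
open import Relation.Nullary using (¬_)
open import Relation.Nullary.Decidable using (_×-dec_)
open import Relation.Binary.PropositionalEquality using (_≡_)
open import Algebra.Bundles using (CommutativeRing)

-- Polynomials over ℚ as coefficient lists, lowest degree first.
-- Lists differing by trailing zeros represent the same polynomial;
-- polynomial equality is coefficientwise (_≈P_).

Poly : Set
Poly = List ℚ

coeff : Poly → ℕ → ℚ
coeff []       _       = 0ℚ
coeff (c ∷ p) zero    = c
coeff (c ∷ p) (suc n) = coeff p n

_≈P_ : Poly → Poly → Set
p ≈P q = ∀ n → coeff p n ≡ coeff q n

const : ℚ → Poly
const c = c ∷ []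

X : Poly
X = 0ℚ ∷ 1ℚ ∷ []

infixl 6 _+P_ _-P_
infixl 7 _*P_ _·P_

_+P_ : Poly → Poly → Poly
[]      +P q       = q
p       +P []      = p
(a ∷ p) +P (b ∷ q) = (a ℚ.+ b) ∷ (p +P q)

_·P_ : ℚ → Poly → Poly
c ·P p = map (c ℚ.*_) p

negP : Poly → Poly
negP p = map ℚ.-_ p

_-P_ : Poly → Poly → Poly
p -P q = p +P negP q

_*P_ : Poly → Poly → Poly
[]      *P q = []
(a ∷ p) *P q = (a ·P q) +P (0ℚ ∷ (p *P q))

_^P_ : Poly → ℕ → Poly
p ^P zero  = const 1ℚ
p ^P suc n = p *P (p ^P n)

prodP : List Poly → Poly
prodP = foldr _*P_ (const 1ℚ)

derivAux : ℕ → Poly → Poly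
derivAux k []      = []
derivAux k (c ∷ p) = ((ℤ.+ k ℚ./ 1) ℚ.* c) ∷ derivAux (suc k) p

deriv : Poly → Poly
deriv []      = []
deriv (c ∷ p) = derivAux 1 p

eval : Poly → ℚ → ℚ
eval []      x = 0ℚ
eval (c ∷ p) x = c ℚ.+ x ℚ.* eval p x

module _ {c ℓ : Level} (R : CommutativeRing c ℓ) where
  open CommutativeRing R
  evalIn : (ℚ → Carrier) → Poly → Carrier → Carrier
  evalIn ι []      z = 0#
  evalIn ι (a ∷ p) z = ι a + z * evalIn ι p z

HasDegree : Poly → ℕ → Set
HasDegree p n = ¬ (coeff p n ≡ 0ℚ) × (∀ k → n ℕ.< k → coeff p k ≡ 0ℚ)

Irreducible : Poly → Set
Irreducible p =
  (Σ ℕ λ n → 1 ℕ.≤ n × HasDegree p n) ×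
  (∀ u v → p ≈P (u *P v) → HasDegree u 0 ⊎ HasDegree v 0)

Separable : Poly → Set
Separable p = Σ Poly λ u → Σ Poly λ v → ((u *P p) +P (v *P deriv p)) ≈P const 1ℚ

IntegralPoly : Poly → Set
IntegralPoly p = ∀ n → ℚ.denominatorℕ (coeff p n) ≡ 1

pairsLt : (r : ℕ) → List (Fin r × Fin r)
pairsLt r = concatMap (λ j → filter (λ jk → toℕ (Data.Product.proj₁ jk) ℕ.<? toℕ (Data.Product.proj₂ jk))
                                   (map (λ k → (j , k)) (allFin r))) (allFin r)

mOf : (r : ℕ) → (Fin r → ℤ) → ℤ
mOf r a = foldr ℤ._*_ (ℤ.+ 1) (map (λ jk → a (Data.Product.proj₁ jk) ℤ.- a (Data.Product.proj₂ jk)) (pairsLt r))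

radical : ℕ → ℕ
radical n = product (filter (λ p → prime? p ×-dec (p ∣? n)) (upTo (suc n)))

gPoly : (r : ℕ) → (Fin r → ℤ) → ℕ → ℕ → Poly
gPoly r a ℓ N =
  ((ℤ.+ (ℓ ℕ.* N ℕ.^ 6) ℚ./ 1) ·P prodP (map (λ i → (X -P const (a i ℚ./ 1)) ^P 6) (allFin r)))
  +P const 1ℚ

fPoly : Poly → Poly → Poly
fPoly h g = g *P (((h -P const 1ℚ) *P g) +P const 1ℚ)

{-# OPTIONS --safe #-}
module Submission where

-- Write a rational root as x = u / v in lowest terms and put Q = ∏ (x - aᵢ) and
-- P = v ^ r * Q = ∏ (u - aᵢ v) ∈ ℤ.  If Q = 0 then x = aᵢ, g (x) = 1 and f (x) = h (aᵢ) = bᵢ ^ d ≠ 0.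
-- Otherwise D = v ^ (6 r) * g (x) = c P⁶ + v ^ (6 r), with c = ℓ N⁶, is a positive integer, a root of
-- the second factor of f satisfies h (x) g (x) = c Q⁶, and since m h has integer coefficients and
-- degree K = 6 r + 3, clearing denominators gives an integer H with H D = m v ^ K c P⁶.  A prime
-- dividing D divides v (primes of m divide N, hence c), so it does not divide P; as 6 r ≥ 12 and
-- no eighth power of a prime divides c, D and c have the same p-part for every such p, so D ∣ c,
-- although D > c.

open import Defs
open import Level using (Level; 0ℓ)
open import Data.Nat.Base as ℕ using (ℕ; zero; suc; _%_; NonZero)
import Data.Nat.Properties as ℕP
open import Data.Nat.Divisibility as ℕ∣ using (divides)
import Data.Nat.Coprimality as Coprimality
open import Data.Nat.GCD using (gcd)
open import Data.Nat.Primality using (Prime; euclidsLemma; ¬prime[1]; prime⇒nonZero)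
open import Data.Integer.Base as ℤ using (ℤ; -[1+_]; +0; +[1+_])
import Data.Integer.Properties as ℤP
import Data.Integer.Divisibility.Signed as ℤ∣
open import Data.Rational.Base as ℚ using (ℚ; 0ℚ)
import Data.Rational.Properties as ℚP
import Data.Rational.Unnormalised.Base as ℚᵘ
import Data.Rational.Unnormalised.Properties as ℚᵘP
open import Data.Fin.Base using (Fin; toℕ)
open import Data.List.Base using (List; []; _∷_; map; foldr; length; allFin)
open import Data.List.Properties using (map-cong; length-tabulate)
open import Data.List.Relation.Unary.All as All using (All; []; _∷_)
import Data.List.Relation.Unary.All.Properties as All
open import Data.List.Membership.Propositional using (_∈_)
open import Data.Empty using (⊥)
open import Data.Product.Base as Product using (∃; _×_; _,_; proj₁; proj₂)
open import Data.Sum.Base using (_⊎_; inj₁; inj₂)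
open import Function.Base using (_∘_; id; case_of_)
open import Function.Definitions using (Injective)
open import Relation.Nullary using (¬_; Dec; yes; no; contradiction)
open import Relation.Nullary.Decidable.Core using (dec⇒maybe)
open import Relation.Binary.PropositionalEquality
open import Algebra.Bundles using (CommutativeRing)
open import Algebra.Morphism.Structures using (IsRingHomomorphism)
open import Tactic.RingSolver using (solve-∀)
open import Tactic.RingSolver.Core.AlmostCommutativeRing using (AlmostCommutativeRing; fromCommutativeRing)

module _ where

  open import Data.Nat.Base
  open import Data.Nat.Properties
  open import Data.Nat.Divisibility
  open import Data.Nat.Primality
  open import Data.Nat.Primality.Factorisation
    using (PrimeFactorisation; factorise; factorisationHasAllPrimeFactors)
  open import Data.Nat.ListAction using (product)
  open import Data.Nat.ListAction.Properties using (∈⇒∣product)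
  open import Data.List.Base using ([]; _∷_; filter; upTo)
  open import Data.List.Relation.Unary.All.Properties using (all-filter)
  open import Data.List.Relation.Unary.AllPairs using (_∷_)
  open import Data.List.Relation.Unary.Unique.Propositional using (Unique)
  import Data.List.Relation.Unary.Unique.Propositional.Properties as Unique
  open import Data.List.Membership.Propositional.Properties using (∈-filter⁺; ∈-upTo⁺)
  open import Relation.Nullary.Decidable using (_×-dec_)
  open import Algebra.Properties.CommutativeSemigroup *-commutativeSemigroup using (interchange)

  private variable m n k p q : ℕ

  SquareFree : ℕ → Set
  SquareFree n = ∀ {p} → Prime p → ¬ p ^ 2 ∣ n

  prime∤1 : Prime p → ¬ p ∣ 1
  prime∤1 pp p∣1 = ¬prime[1] (subst Prime (∣1⇒≡1 p∣1) pp)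

  prime∣prime⇒≡ : Prime p → Prime q → p ∣ q → p ≡ q
  prime∣prime⇒≡ pp pq p∣q with prime⇒irreducible pq p∣q
  ... | inj₁ refl = contradiction pp ¬prime[1]
  ... | inj₂ p≡q  = p≡q

  prime∣^⇒∣ : Prime p → ∀ n → p ∣ m ^ n → p ∣ m
  prime∣^⇒∣ pp zero    p∣1       = contradiction p∣1 (prime∤1 pp)
  prime∣^⇒∣ {m = m} pp (suc n) p∣m^[1+n] with euclidsLemma m (m ^ n) pp p∣m^[1+n]
  ... | inj₁ p∣m   = p∣m
  ... | inj₂ p∣m^n = prime∣^⇒∣ pp n p∣m^n

  [m*n]^k≡m^k*n^k : ∀ m n k → (m * n) ^ k ≡ m ^ k * n ^ k
  [m*n]^k≡m^k*n^k m n zero    = refl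
  [m*n]^k≡m^k*n^k m n (suc k) =
    trans (cong (m * n *_) ([m*n]^k≡m^k*n^k m n k)) (interchange m n (m ^ k) (n ^ k))

  ^-monoˡ-∣ : ∀ n → m ∣ k → m ^ n ∣ k ^ n
  ^-monoˡ-∣ zero    m∣k = ∣-refl
  ^-monoˡ-∣ (suc n) m∣k = *-pres-∣ m∣k (^-monoˡ-∣ n m∣k)

  ^-monoʳ-∣ : ∀ p → m ≤ n → p ^ m ∣ p ^ n
  ^-monoʳ-∣ {m} {n} p m≤n = subst (λ j → p ^ m ∣ p ^ j) (m+[n∸m]≡n m≤n)
    (subst (p ^ m ∣_) (sym (^-distribˡ-+-* p m (n ∸ m))) (m∣m*n (p ^ (n ∸ m))))

  prime^k∣m*n⇒prime^k∣m : Prime p → ¬ p ∣ n → ∀ k → p ^ k ∣ m * n → p ^ k ∣ m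
  prime^k∣m*n⇒prime^k∣m {m = m} pp p∤n zero    _ = 1∣ m
  prime^k∣m*n⇒prime^k∣m {p} {n} {m} pp p∤n (suc k) p^[1+k]∣mn
    with euclidsLemma m n pp (∣-trans (m∣m*n (p ^ k)) p^[1+k]∣mn)
  ... | inj₂ p∣n            = contradiction p∣n p∤n
  ... | inj₁ (divides q refl) =
    subst (p * p ^ k ∣_) (*-comm p q) (*-monoʳ-∣ p (prime^k∣m*n⇒prime^k∣m pp p∤n k p^k∣qn))
    where
    instance
      p≢0 : NonZero p
      p≢0 = prime⇒nonZero pp
    p^k∣qn : p ^ k ∣ q * n
    p^k∣qn = *-cancelˡ-∣ p (subst (p * p ^ k ∣_) (trans (cong (_* n) (*-comm q p)) (*-assoc p q n)) p^[1+k]∣mn)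

  product∣-by-prime-powers : ∀ {ps} → All Prime ps →
                             (∀ {p} k → Prime p → p ^ k ∣ product ps → p ^ k ∣ n) → product ps ∣ n
  product∣-by-prime-powers [] _ = 1∣ _
  product∣-by-prime-powers {n} {q ∷ qs} (pq ∷ pqs) prime-powers
    with prime-powers 1 pq (subst (_∣ q * product qs) (sym (*-identityʳ q)) (m∣m*n _))
  ... | q^1∣n with subst (_∣ n) (*-identityʳ q) q^1∣n
  ... | divides n′ refl =
    subst (q * product qs ∣_) (*-comm q n′) (*-monoʳ-∣ q (product∣-by-prime-powers pqs prime-powers′))
    where
    instance
      q≢0 : NonZero q
      q≢0 = prime⇒nonZero pq
    prime-powers′ : ∀ {p} k → Prime p → p ^ k ∣ product qs → p ^ k ∣ n′
    prime-powers′ {p} k pp p^k∣qs with p ≟ q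
    ... | yes refl =
      *-cancelˡ-∣ p (subst (p * p ^ k ∣_) (*-comm n′ p) (prime-powers (suc k) pp (*-monoʳ-∣ p p^k∣qs)))
    ... | no p≢q =
      prime^k∣m*n⇒prime^k∣m pp (p≢q ∘ prime∣prime⇒≡ pp pq) k (prime-powers k pp (∣-trans p^k∣qs (n∣m*n q)))

  ∣-by-prime-powers : .{{NonZero m}} → (∀ {p} k → Prime p → p ^ k ∣ m → p ^ k ∣ n) → m ∣ n
  ∣-by-prime-powers {m} prime-powers = subst (_∣ _) (sym isFactorisation)
    (product∣-by-prime-powers factorsPrime (λ k pp → prime-powers k pp ∘ subst (_ ∣_) (sym isFactorisation)))
    where open PrimeFactorisation (factorise m)

  -- Below e the p-part of c * Q + V is that of c, so it can never reach e.
  prime^k∣c*Q+V⇒prime^k∣c : ∀ {c Q V e} → Prime p → ¬ p ∣ Q → p ^ e ∣ V → ¬ p ^ e ∣ c →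
                            ∀ k → p ^ k ∣ c * Q + V → p ^ k ∣ c
  prime^k∣c*Q+V⇒prime^k∣c {p} {c} {Q} {V} {e} pp p∤Q p^e∣V p^e∤c k p^k∣D = case k ≤? e of λ where
      (yes k≤e) → below k≤e p^k∣D
      (no  k≰e) → contradiction (below ≤-refl (∣-trans (^-monoʳ-∣ p (<⇒≤ (≰⇒> k≰e))) p^k∣D)) p^e∤c
    where
    below : ∀ {j} → j ≤ e → p ^ j ∣ c * Q + V → p ^ j ∣ c
    below {j} j≤e p^j∣D = prime^k∣m*n⇒prime^k∣m pp p∤Q j
      (∣m+n∣m⇒∣n (subst (p ^ j ∣_) (+-comm (c * Q) V) p^j∣D) (∣-trans (^-monoʳ-∣ p j≤e) p^e∣V))

  prime⇒squareFree : Prime q → SquareFree q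
  prime⇒squareFree {q} pq {p} pp p²∣q with prime∣prime⇒≡ pp pq (∣-trans (m∣m*n (p ^ 1)) p²∣q)
  ... | refl = prime∤1 pq (∣-trans (m∣m*n 1) (*-cancelˡ-∣ q {{prime⇒nonZero pq}}
                 (subst (q ^ 2 ∣_) (sym (*-identityʳ q)) p²∣q)))

  ¬prime^[2+k]∣m*n^k : SquareFree m → SquareFree n → Prime p → ∀ k → ¬ p ^ (2 + k) ∣ m * n ^ k
  ¬prime^[2+k]∣m*n^k {m} {n} {p} m-sf n-sf pp k p^[2+k]∣ with p ∣? n
  ... | no p∤n = m-sf pp (∣-trans (^-monoʳ-∣ p (m≤m+n 2 k))
                   (prime^k∣m*n⇒prime^k∣m pp (p∤n ∘ prime∣^⇒∣ pp k) (2 + k) p^[2+k]∣))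
  ... | yes (divides n′ refl) = m-sf pp (prime^k∣m*n⇒prime^k∣m pp (p∤n′ ∘ prime∣^⇒∣ pp k) 2 p²∣mn′^k)
    where
    p∤n′ : ¬ p ∣ n′
    p∤n′ p∣n′ = n-sf pp (subst (_∣ n′ * p) (cong (p *_) (sym (*-identityʳ p))) (*-monoˡ-∣ p p∣n′))
    p²∣mn′^k : p ^ 2 ∣ m * n′ ^ k
    p²∣mn′^k = *-cancelʳ-∣ (p ^ k) {{m^n≢0 p k {{prime⇒nonZero pp}}}}
      (subst₂ _∣_ (^-distribˡ-+-* p 2 k)
                  (trans (cong (m *_) ([m*n]^k≡m^k*n^k n′ p k)) (sym (*-assoc m _ _))) p^[2+k]∣)

  product-squareFree : ∀ {ps} → Unique ps → All Prime ps → SquareFree (product ps)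
  product-squareFree {[]} _ _ {p} pp p²∣1 = prime∤1 pp (∣-trans (m∣m*n (p ^ 1)) p²∣1)
  product-squareFree {q ∷ qs} (q∉qs ∷ qs-unique) (pq ∷ qs-prime) {p} pp p²∣ with p ≟ q
  ... | yes refl = All.lookup q∉qs (factorisationHasAllPrimeFactors pp p∣qs qs-prime) refl
    where
    p∣qs : p ∣ product qs
    p∣qs = ∣-trans (m∣m*n 1) (*-cancelˡ-∣ p {{prime⇒nonZero pp}} p²∣)
  ... | no p≢q = product-squareFree qs-unique qs-prime pp
    (prime^k∣m*n⇒prime^k∣m pp (p≢q ∘ prime∣prime⇒≡ pp pq) 2 (subst (p ^ 2 ∣_) (*-comm q _) p²∣))

  module _ (n : ℕ) where

    private
      P? : ∀ q → Dec (Prime q × q ∣ n)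
      P? q = prime? q ×-dec (q ∣? n)
      radical-primes : All Prime (filter P? (upTo (suc n)))
      radical-primes = All.map proj₁ (all-filter P? (upTo (suc n)))

    radical≢0 : NonZero (radical n)
    radical≢0 = productOfPrimes≢0 radical-primes

    radical-squareFree : SquareFree (radical n)
    radical-squareFree = product-squareFree (Unique.filter⁺ P? (Unique.upTo⁺ (suc n))) radical-primes

    prime∣⇒prime∣radical : .{{NonZero n}} → Prime p → p ∣ n → p ∣ radical n
    prime∣⇒prime∣radical pp p∣n = ∈⇒∣product (∈-filter⁺ P? (∈-upTo⁺ (s≤s (∣⇒≤ p∣n))) (pp , p∣n))

  c*P^e+v^n∤M*[v^K*[c*P^e]] : ∀ {c P v M s} e n K → .{{NonZero c}} → .{{NonZero P}} → .{{NonZero v}} →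
    (∀ {p} → Prime p → p ∣ M → p ∣ c) →
    (∀ {p} → Prime p → p ∣ v → ¬ p ∣ P) →
    (∀ {p} → Prime p → ¬ p ^ s ∣ c) → s ≤ n →
    ¬ (c * P ^ e + v ^ n ∣ M * (v ^ K * (c * P ^ e)))
  c*P^e+v^n∤M*[v^K*[c*P^e]] {c} {P} {v} {M} {s} e n K M-primes v⊥P c-free s≤n D∣ = <⇒≱ c<D (∣⇒≤ D∣c)
    where
    A D : ℕ
    A = c * P ^ e
    D = A + v ^ n

    c<D : c < D
    c<D = ≤-<-trans (m≤m*n c (P ^ e) {{m^n≢0 P e}}) (m<m+n A (m^n>0 v n))

    ∣A⇒∣v : Prime p → p ∣ D → p ∣ A → p ∣ v
    ∣A⇒∣v pp p∣D p∣A = prime∣^⇒∣ pp n (∣m+n∣m⇒∣n p∣D p∣A)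

    prime∣D⇒∣v : Prime p → p ∣ D → p ∣ v
    prime∣D⇒∣v pp p∣D with euclidsLemma M (v ^ K * A) pp (∣-trans p∣D D∣)
    ... | inj₁ p∣M = ∣A⇒∣v pp p∣D (∣m⇒∣m*n (P ^ e) (M-primes pp p∣M))
    ... | inj₂ p∣v^K*A with euclidsLemma (v ^ K) A pp p∣v^K*A
    ...   | inj₁ p∣v^K = prime∣^⇒∣ pp K p∣v^K
    ...   | inj₂ p∣A   = ∣A⇒∣v pp p∣D p∣A

    prime-powers : ∀ {p} k → Prime p → p ^ k ∣ D → p ^ k ∣ c
    prime-powers zero pp _ = 1∣ c
    prime-powers {p} (suc k) pp p^[1+k]∣D =
      prime^k∣c*Q+V⇒prime^k∣c {e = s} pp (v⊥P pp p∣v ∘ prime∣^⇒∣ pp e)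
        (∣-trans (^-monoʳ-∣ p s≤n) (^-monoˡ-∣ n p∣v)) (c-free pp) (suc k) p^[1+k]∣D
      where
      p∣v : p ∣ v
      p∣v = prime∣D⇒∣v pp (∣-trans (m∣m*n (p ^ k)) p^[1+k]∣D)

    D∣c : D ∣ c
    D∣c = ∣-by-prime-powers {{>-nonZero (≤-<-trans z≤n c<D)}} prime-powers

open import Data.Rational.Base using (mkℚ; 1ℚ; _+_; _*_; -_; _-_; _/_; ↥_; ↧_)
open import Algebra.Properties.CommutativeSemiring.Exp
  (CommutativeRing.commutativeSemiring ℚP.+-*-commutativeRing)
  using (_^_; ^-distrib-*; ^-assocʳ)
open ≡-Reasoning

private
  ℚ-ring : AlmostCommutativeRing 0ℓ 0ℓ
  ℚ-ring = fromCommutativeRing ℚP.+-*-commutativeRing (λ z → dec⇒maybe (0ℚ ℚP.≟ z))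
  variable A : Set

toℚ : ℤ → ℚ
toℚ i = i / 1

private
  mkℚ[_/1] : ℤ → ℚ
  mkℚ[ i /1] = mkℚ i 0 (Coprimality.sym (Coprimality.1-coprimeTo ℤ.∣ i ∣))

  toℚ≡mkℚ : ∀ i → toℚ i ≡ mkℚ[ i /1]
  toℚ≡mkℚ (ℤ.+ n)  = ℚP.normalize-coprime (Coprimality.sym (Coprimality.1-coprimeTo n))
  toℚ≡mkℚ -[1+ n ] = cong -_ (ℚP.normalize-coprime (Coprimality.sym (Coprimality.1-coprimeTo (suc n))))

toℚ-injective : ∀ {i j} → toℚ i ≡ toℚ j → i ≡ j
toℚ-injective {i} {j} eq = cong ↥_ (trans (sym (toℚ≡mkℚ i)) (trans eq (toℚ≡mkℚ j)))

toℚ-homo-* : ∀ i j → toℚ (i ℤ.* j) ≡ toℚ i * toℚ j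
toℚ-homo-* i j rewrite toℚ≡mkℚ i | toℚ≡mkℚ j = refl

toℚ-homo-+ : ∀ i j → toℚ (i ℤ.+ j) ≡ toℚ i + toℚ j
toℚ-homo-+ i j rewrite toℚ≡mkℚ i | toℚ≡mkℚ j =
  cong₂ (λ m n → (m ℤ.+ n) / 1) (sym (ℤP.*-identityʳ i)) (sym (ℤP.*-identityʳ j))

toℚ-homo-neg : ∀ i → toℚ (ℤ.- i) ≡ - toℚ i
toℚ-homo-neg i = trans (toℚ≡mkℚ (ℤ.- i)) (trans (neg-mkℚ i) (cong -_ (sym (toℚ≡mkℚ i))))
  where
  neg-mkℚ : ∀ i → mkℚ[ ℤ.- i /1] ≡ - mkℚ[ i /1]
  neg-mkℚ +0       = refl
  neg-mkℚ +[1+ n ] = refl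
  neg-mkℚ -[1+ n ] = refl

toℚ-homo-sub : ∀ i j → toℚ (i ℤ.- j) ≡ toℚ i - toℚ j
toℚ-homo-sub i j = trans (toℚ-homo-+ i (ℤ.- j)) (cong (toℚ i +_) (toℚ-homo-neg j))

toℚ-homo-^ : ∀ i n → toℚ (i ℤ.^ n) ≡ toℚ i ^ n
toℚ-homo-^ i zero    = refl
toℚ-homo-^ i (suc n) = trans (toℚ-homo-* i (i ℤ.^ n)) (cong (toℚ i *_) (toℚ-homo-^ i n))

*-denominator≡numerator : ∀ p → p * toℚ (↧ p) ≡ toℚ (↥ p)
*-denominator≡numerator p@(mkℚ u d _) rewrite toℚ≡mkℚ (↧ p) | toℚ≡mkℚ u =
  ℚP.toℚᵘ-injective (ℚᵘP.≃-trans (ℚP.toℚᵘ-homo-* p mkℚ[ ↧ p /1])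
    (ℚᵘ.*≡* (trans (ℤP.*-identityʳ _) (cong (λ k → u ℤ.* ℤ.+ suc k) (sym (ℕP.*-identityʳ d))))))

↥-↧-coprime : ∀ p → Coprimality.Coprime ℤ.∣ ↥ p ∣ (ℚ.↧ₙ p)
↥-↧-coprime (mkℚ _ _ coprime) = Coprimality.recompute coprime

integral⇒≡toℚ↥ : ∀ q → ℚ.denominatorℕ q ≡ 1 → q ≡ toℚ (↥ q)
integral⇒≡toℚ↥ (mkℚ n zero _) refl = sym (toℚ≡mkℚ n)

p*q≡0⇒p≡0∨q≡0 : ∀ p q → p * q ≡ 0ℚ → p ≡ 0ℚ ⊎ q ≡ 0ℚ
p*q≡0⇒p≡0∨q≡0 p q pq≡0 with p ℚP.≟ 0ℚ
... | yes p≡0 = inj₁ p≡0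
... | no  p≢0 = inj₂ (begin
  q                ≡⟨ sym (ℚP.*-identityˡ q) ⟩
  1ℚ * q           ≡⟨ cong (_* q) (sym (ℚP.*-inverseˡ p)) ⟩
  ℚ.1/ p * p * q   ≡⟨ ℚP.*-assoc (ℚ.1/ p) p q ⟩
  ℚ.1/ p * (p * q) ≡⟨ cong (ℚ.1/ p *_) pq≡0 ⟩
  ℚ.1/ p * 0ℚ      ≡⟨ ℚP.*-zeroʳ (ℚ.1/ p) ⟩
  0ℚ               ∎)
  where
  instance
    p≢0′ : ℚ.NonZero p
    p≢0′ = ℚ.≢-nonZero p≢0

*-cancelˡ-≡0 : ∀ p q → p ≢ 0ℚ → p * q ≡ 0ℚ → q ≡ 0ℚ
*-cancelˡ-≡0 p q p≢0 pq≡0 with p*q≡0⇒p≡0∨q≡0 p q pq≡0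
... | inj₁ p≡0 = contradiction p≡0 p≢0
... | inj₂ q≡0 = q≡0

^≢0 : ∀ p n → p ≢ 0ℚ → p ^ n ≢ 0ℚ
^≢0 p zero    p≢0 ()
^≢0 p (suc n) p≢0 p^[1+n]≡0 with p*q≡0⇒p≡0∨q≡0 p (p ^ n) p^[1+n]≡0
... | inj₁ p≡0   = p≢0 p≡0
... | inj₂ p^n≡0 = ^≢0 p n p≢0 p^n≡0

p-q≡0⇒p≡q : ∀ p q → p - q ≡ 0ℚ → p ≡ q
p-q≡0⇒p≡q p q p-q≡0 = trans (split p q) (trans (cong (_+ q) p-q≡0) (ℚP.+-identityˡ q))
  where
  split : ∀ p q → p ≡ (p - q) + q
  split = solve-∀ ℚ-ring

^-zeroˡ : ∀ n → 1ℚ ^ n ≡ 1ℚ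
^-zeroˡ zero    = refl
^-zeroˡ (suc n) = trans (ℚP.*-identityˡ _) (^-zeroˡ n)

pos-^ : ∀ m n → (ℤ.+ m) ℤ.^ n ≡ ℤ.+ (m ℕ.^ n)
pos-^ m zero    = refl
pos-^ m (suc n) = trans (cong ((ℤ.+ m) ℤ.*_) (pos-^ m n)) (sym (ℤP.pos-* m (m ℕ.^ n)))

-- Stated for n * 2 so that suc n * 2 computes to 2 + n * 2 and 6 is 3 * 2.
^-even : ∀ i n → i ℤ.^ (n ℕ.* 2) ≡ ℤ.+ (ℤ.∣ i ∣ ℕ.^ (n ℕ.* 2))
^-even i zero    = refl
^-even i (suc n) = begin
  i ℤ.* (i ℤ.* i ℤ.^ (n ℕ.* 2))                ≡⟨ sym (ℤP.*-assoc i i _) ⟩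
  i ℤ.* i ℤ.* i ℤ.^ (n ℕ.* 2)                  ≡⟨ cong₂ ℤ._*_ (square i) (^-even i n) ⟩
  (ℤ.+ (∣i∣ ℕ.* ∣i∣)) ℤ.* (ℤ.+ (∣i∣ ℕ.^ (n ℕ.* 2))) ≡⟨ sym (ℤP.pos-* (∣i∣ ℕ.* ∣i∣) _) ⟩
  ℤ.+ (∣i∣ ℕ.* ∣i∣ ℕ.* ∣i∣ ℕ.^ (n ℕ.* 2))       ≡⟨ cong ℤ.+_ (ℕP.*-assoc ∣i∣ ∣i∣ _) ⟩
  ℤ.+ (∣i∣ ℕ.^ (suc n ℕ.* 2))                  ∎
  where
  ∣i∣ : ℕ
  ∣i∣ = ℤ.∣ i ∣
  square : ∀ i → i ℤ.* i ≡ ℤ.+ (ℤ.∣ i ∣ ℕ.* ℤ.∣ i ∣)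
  square (ℤ.+ n)  = sym (ℤP.pos-* n n)
  square -[1+ n ] = refl

∣u-a*v∣∧∣v⇒∣u : ∀ {p} u a v →
                p ℕ∣.∣ ℤ.∣ u ℤ.- a ℤ.* v ∣ → p ℕ∣.∣ ℤ.∣ v ∣ → p ℕ∣.∣ ℤ.∣ u ∣
∣u-a*v∣∧∣v⇒∣u {p} u a v p∣u-av p∣v = ℤ∣.∣⇒∣ᵤ {ℤ.+ p} {u} (ℤ∣.∣m+n∣n⇒∣m {ℤ.+ p} {u}
  (ℤ∣.∣ᵤ⇒∣ {ℤ.+ p} {u ℤ.- a ℤ.* v} p∣u-av)
  (ℤ∣.∣m⇒∣-m (ℤ∣.∣n⇒∣m*n a (ℤ∣.∣ᵤ⇒∣ {ℤ.+ p} {v} p∣v))))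

∏ℚ : (A → ℚ) → List A → ℚ
∏ℚ f is = foldr _*_ 1ℚ (map f is)

∏ℚ-^ : ∀ (f : A → ℚ) n is → ∏ℚ (λ i → f i ^ n) is ≡ ∏ℚ f is ^ n
∏ℚ-^ f n []       = sym (^-zeroˡ n)
∏ℚ-^ f n (i ∷ is) = trans (cong (f i ^ n *_) (∏ℚ-^ f n is)) (sym (^-distrib-* (f i) (∏ℚ f is) n))

∏ℚ≡0⇒∃≡0 : ∀ (f : A → ℚ) is → ∏ℚ f is ≡ 0ℚ → ∃ λ i → f i ≡ 0ℚ
∏ℚ≡0⇒∃≡0 f []       ()
∏ℚ≡0⇒∃≡0 f (i ∷ is) ∏≡0 with p*q≡0⇒p≡0∨q≡0 (f i) (∏ℚ f is) ∏≡0
... | inj₁ fi≡0 = i , fi≡0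
... | inj₂ ∏≡0′ = ∏ℚ≡0⇒∃≡0 f is ∏≡0′

∏ℤ : (A → ℤ) → List A → ℤ
∏ℤ f is = foldr ℤ._*_ (ℤ.+ 1) (map f is)

∏-homogenise : ∀ x (α : A → ℤ) is → toℚ (↧ x) ^ length is * ∏ℚ (λ i → x - toℚ (α i)) is
                                   ≡ toℚ (∏ℤ (λ i → ↥ x ℤ.- α i ℤ.* ↧ x) is)
∏-homogenise x α []       = ℚP.*-identityˡ 1ℚ
∏-homogenise x α (i ∷ is) = begin
  w * w^n * ((x - a) * ∏)          ≡⟨ regroup w w^n x a ∏ ⟩
  (x * w - a * w) * (w^n * ∏)      ≡⟨ cong₂ (λ s t → (s - t) * (w^n * ∏)) xv≡u (sym (toℚ-homo-* (α i) v)) ⟩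
  (toℚ u - toℚ (α i ℤ.* v)) * (w^n * ∏)
    ≡⟨ cong₂ _*_ (sym (toℚ-homo-sub u (α i ℤ.* v))) (∏-homogenise x α is) ⟩
  toℚ (u ℤ.- α i ℤ.* v) * toℚ (∏ℤ (λ i → u ℤ.- α i ℤ.* v) is)
    ≡⟨ sym (toℚ-homo-* (u ℤ.- α i ℤ.* v) (∏ℤ (λ i → u ℤ.- α i ℤ.* v) is)) ⟩
  toℚ (∏ℤ (λ i → u ℤ.- α i ℤ.* v) (i ∷ is)) ∎
  where
  u v : ℤ
  u = ↥ x
  v = ↧ x
  w w^n a ∏ : ℚ
  w = toℚ v
  w^n = w ^ length is
  a = toℚ (α i)
  ∏ = ∏ℚ (λ i → x - toℚ (α i)) is
  xv≡u : x * w ≡ toℚ u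
  xv≡u = *-denominator≡numerator x
  regroup : ∀ w p y z q → (w * p) * ((y - z) * q) ≡ (y * w - z * w) * (p * q)
  regroup = solve-∀ ℚ-ring

∏ℤ≢0 : ∀ (f : A → ℤ) {is} → All (λ i → f i ≢ ℤ.0ℤ) is → ∏ℤ f is ≢ ℤ.0ℤ
∏ℤ≢0 f []               ()
∏ℤ≢0 f (fi≢0 ∷ fis≢0) ∏≡0 with ℤP.i*j≡0⇒i≡0∨j≡0 _ ∏≡0
... | inj₁ fi≡0 = fi≢0 fi≡0
... | inj₂ ∏≡0′ = ∏ℤ≢0 f fis≢0 ∏≡0′

prime∣∏ℤ⇒∣factor : ∀ {p} → Prime p → (f : A → ℤ) → ∀ is →
                    p ℕ∣.∣ ℤ.∣ ∏ℤ f is ∣ → ∃ λ i → p ℕ∣.∣ ℤ.∣ f i ∣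
prime∣∏ℤ⇒∣factor pp f []       p∣1 = contradiction p∣1 (prime∤1 pp)
prime∣∏ℤ⇒∣factor pp f (i ∷ is) p∣∏
  with euclidsLemma _ _ pp (subst (_ ℕ∣.∣_) (ℤP.abs-* (f i) (∏ℤ f is)) p∣∏)
... | inj₁ p∣fi = i , p∣fi
... | inj₂ p∣∏′ = prime∣∏ℤ⇒∣factor pp f is p∣∏′

mOf≢0 : ∀ r (a : Fin r → ℤ) → Injective _≡_ _≡_ a → mOf r a ≢ ℤ.0ℤ
mOf≢0 r a a-injective = ∏ℤ≢0 (λ jk → a (proj₁ jk) ℤ.- a (proj₂ jk)) (All.map distinct ordered)
  where
  ordered : All (λ jk → toℕ (proj₁ jk) ℕ.< toℕ (proj₂ jk)) (pairsLt r)
  ordered = All.concat⁺ (All.map⁺ (All.universal (λ j → All.all-filter _ (map (j ,_) (allFin r))) (allFin r)))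
  distinct : ∀ {jk} → toℕ (proj₁ jk) ℕ.< toℕ (proj₂ jk) → a (proj₁ jk) ℤ.- a (proj₂ jk) ≢ ℤ.0ℤ
  distinct j<k aj-ak≡0 = ℕP.<-irrefl (cong toℕ (a-injective (ℤP.i-j≡0⇒i≡j _ _ aj-ak≡0))) j<k

eval-+P : ∀ p q x → eval (p +P q) x ≡ eval p x + eval q x
eval-+P []      q       x = sym (ℚP.+-identityˡ _)
eval-+P (a ∷ p) []      x = sym (ℚP.+-identityʳ _)
eval-+P (a ∷ p) (b ∷ q) x =
  trans (cong (λ t → a + b + x * t) (eval-+P p q x)) (regroup a b x (eval p x) (eval q x))
  where
  regroup : ∀ a b x e f → a + b + x * (e + f) ≡ a + x * e + (b + x * f)
  regroup = solve-∀ ℚ-ring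

eval-·P : ∀ c p x → eval (c ·P p) x ≡ c * eval p x
eval-·P c []      x = sym (ℚP.*-zeroʳ c)
eval-·P c (a ∷ p) x = trans (cong (λ t → c * a + x * t) (eval-·P c p x)) (regroup c a x (eval p x))
  where
  regroup : ∀ c a x e → c * a + x * (c * e) ≡ c * (a + x * e)
  regroup = solve-∀ ℚ-ring

eval-negP : ∀ p x → eval (negP p) x ≡ - eval p x
eval-negP []      x = refl
eval-negP (a ∷ p) x = trans (cong (λ t → - a + x * t) (eval-negP p x)) (regroup a x (eval p x))
  where
  regroup : ∀ a x e → - a + x * - e ≡ - (a + x * e)
  regroup = solve-∀ ℚ-ring

eval-subP : ∀ p q x → eval (p -P q) x ≡ eval p x - eval q x
eval-subP p q x = trans (eval-+P p (negP q) x) (cong (eval p x +_) (eval-negP q x))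

eval-*P : ∀ p q x → eval (p *P q) x ≡ eval p x * eval q x
eval-*P []      q x = sym (ℚP.*-zeroˡ (eval q x))
eval-*P (a ∷ p) q x = begin
  eval (a ·P q +P (0ℚ ∷ p *P q)) x                ≡⟨ eval-+P (a ·P q) (0ℚ ∷ p *P q) x ⟩
  eval (a ·P q) x + (0ℚ + x * eval (p *P q) x)    ≡⟨ cong₂ (λ s t → s + (0ℚ + x * t)) (eval-·P a q x) (eval-*P p q x) ⟩
  a * eval q x + (0ℚ + x * (eval p x * eval q x)) ≡⟨ regroup a x (eval p x) (eval q x) ⟩
  (a + x * eval p x) * eval q x                   ∎
  where
  regroup : ∀ a x e f → a * f + (0ℚ + x * (e * f)) ≡ (a + x * e) * f
  regroup = solve-∀ ℚ-ring

eval-const : ∀ c x → eval (const c) x ≡ c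
eval-const c x = trans (cong (c +_) (ℚP.*-zeroʳ x)) (ℚP.+-identityʳ c)

eval-X : ∀ x → eval X x ≡ x
eval-X x = trans (cong (λ t → 0ℚ + x * t) (eval-const 1ℚ x)) (identity x)
  where
  identity : ∀ x → 0ℚ + x * 1ℚ ≡ x
  identity = solve-∀ ℚ-ring

eval-^P : ∀ p n x → eval (p ^P n) x ≡ eval p x ^ n
eval-^P p zero    x = eval-const 1ℚ x
eval-^P p (suc n) x = trans (eval-*P p (p ^P n) x) (cong (eval p x *_) (eval-^P p n x))

eval-prodP : ∀ (F : A → Poly) is x → eval (prodP (map F is)) x ≡ ∏ℚ (λ i → eval (F i) x) is
eval-prodP F []       x = eval-const 1ℚ x
eval-prodP F (i ∷ is) x = trans (eval-*P (F i) _ x) (cong (eval (F i) x *_) (eval-prodP F is x))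

eval-zero : ∀ p x → (∀ k → coeff p k ≡ 0ℚ) → eval p x ≡ 0ℚ
eval-zero []      x _     = refl
eval-zero (a ∷ p) x coeff≡0 = begin
  a + x * eval p x ≡⟨ cong₂ (λ s t → s + x * t) (coeff≡0 0) (eval-zero p x (coeff≡0 ∘ suc)) ⟩
  0ℚ + x * 0ℚ      ≡⟨ cong (0ℚ +_) (ℚP.*-zeroʳ x) ⟩
  0ℚ               ∎

coeff-·P : ∀ c p k → coeff (c ·P p) k ≡ c * coeff p k
coeff-·P c []      k       = sym (ℚP.*-zeroʳ c)
coeff-·P c (a ∷ p) zero    = refl
coeff-·P c (a ∷ p) (suc k) = coeff-·P c p k

coeff-·P-above-degree : ∀ c {p n} → HasDegree p n → ∀ k → n ℕ.< k → coeff (c ·P p) k ≡ 0ℚ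
coeff-·P-above-degree c {p} (_ , above) k n<k =
  trans (coeff-·P c p k) (trans (cong (c *_) (above k n<k)) (ℚP.*-zeroʳ c))

eval-clearDenominators : ∀ x p K → IntegralPoly p →
  (∀ k → K ℕ.< k → coeff p k ≡ 0ℚ) → ∃ λ H → toℚ (↧ x) ^ K * eval p x ≡ toℚ H
eval-clearDenominators x [] K _ _ = ℤ.+ 0 , ℚP.*-zeroʳ (toℚ (↧ x) ^ K)
eval-clearDenominators x (c ∷ p) zero integral deg = ↥ c , (begin
  1ℚ * (c + x * eval p x) ≡⟨ cong (λ t → 1ℚ * (c + x * t)) (eval-zero p x (λ k → deg (suc k) ℕ.z<s)) ⟩
  1ℚ * (c + x * 0ℚ)       ≡⟨ identity c x ⟩
  c                       ≡⟨ integral⇒≡toℚ↥ c (integral 0) ⟩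
  toℚ (↥ c)               ∎)
  where
  identity : ∀ c x → 1ℚ * (c + x * 0ℚ) ≡ c
  identity = solve-∀ ℚ-ring
eval-clearDenominators x (c ∷ p) (suc K) integral deg
  with eval-clearDenominators x p K (integral ∘ suc) (λ k K<k → deg (suc k) (ℕ.s<s K<k))
... | H , w^K*p[x]≡H = v ℤ.^ suc K ℤ.* ↥ c ℤ.+ u ℤ.* H , (begin
  w ^ suc K * (c + x * eval p x)                           ≡⟨ regroup w (w ^ K) c x (eval p x) ⟩
  w ^ suc K * c + (x * w) * (w ^ K * eval p x)
    ≡⟨ cong₂ (λ s t → w ^ suc K * s + t * (w ^ K * eval p x))
             (integral⇒≡toℚ↥ c (integral 0)) (*-denominator≡numerator x) ⟩
  w ^ suc K * toℚ (↥ c) + toℚ u * (w ^ K * eval p x)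
    ≡⟨ cong₂ (λ s t → s * toℚ (↥ c) + toℚ u * t) (sym (toℚ-homo-^ v (suc K))) w^K*p[x]≡H ⟩
  toℚ (v ℤ.^ suc K) * toℚ (↥ c) + toℚ u * toℚ H
    ≡⟨ sym (cong₂ _+_ (toℚ-homo-* (v ℤ.^ suc K) (↥ c)) (toℚ-homo-* u H)) ⟩
  toℚ (v ℤ.^ suc K ℤ.* ↥ c) + toℚ (u ℤ.* H)                ≡⟨ sym (toℚ-homo-+ (v ℤ.^ suc K ℤ.* ↥ c) (u ℤ.* H)) ⟩
  toℚ (v ℤ.^ suc K ℤ.* ↥ c ℤ.+ u ℤ.* H)                    ∎)
  where
  u v : ℤ
  u = ↥ x
  v = ↧ x
  w : ℚ
  w = toℚ v
  regroup : ∀ w wK c x e → (w * wK) * (c + x * e) ≡ (w * wK) * c + (x * w) * (wK * e)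
  regroup = solve-∀ ℚ-ring

eval-fPoly : ∀ h g x → eval (fPoly h g) x ≡ eval g x * ((eval h x - 1ℚ) * eval g x + 1ℚ)
eval-fPoly h g x = begin
  eval (fPoly h g) x                                    ≡⟨ eval-*P g _ x ⟩
  eval g x * eval (h-1 *P g +P const 1ℚ) x              ≡⟨ cong (eval g x *_) (eval-+P (h-1 *P g) (const 1ℚ) x) ⟩
  eval g x * (eval (h-1 *P g) x + eval (const 1ℚ) x)    ≡⟨ cong₂ (λ s t → eval g x * (s + t)) (eval-*P h-1 g x) (eval-const 1ℚ x) ⟩
  eval g x * (eval h-1 x * eval g x + 1ℚ)               ≡⟨ cong (λ s → eval g x * (s * eval g x + 1ℚ)) eval-h-1 ⟩
  eval g x * ((eval h x - 1ℚ) * eval g x + 1ℚ)          ∎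
  where
  h-1 : Poly
  h-1 = h -P const 1ℚ
  eval-h-1 : eval h-1 x ≡ eval h x - 1ℚ
  eval-h-1 = trans (eval-subP h (const 1ℚ) x) (cong (λ t → eval h x - t) (eval-const 1ℚ x))

eval-gPoly : ∀ r a ℓ N x →
  eval (gPoly r a ℓ N) x ≡ toℚ (ℤ.+ (ℓ ℕ.* N ℕ.^ 6)) * ∏ℚ (λ i → x - toℚ (a i)) (allFin r) ^ 6 + 1ℚ
eval-gPoly r a ℓ N x = begin
  eval (c ·P prodP (map F is) +P const 1ℚ) x          ≡⟨ eval-+P (c ·P prodP (map F is)) (const 1ℚ) x ⟩
  eval (c ·P prodP (map F is)) x + eval (const 1ℚ) x  ≡⟨ cong₂ _+_ (eval-·P c (prodP (map F is)) x) (eval-const 1ℚ x) ⟩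
  c * eval (prodP (map F is)) x + 1ℚ                  ≡⟨ cong (λ t → c * t + 1ℚ) (eval-prodP F is x) ⟩
  c * ∏ℚ (λ i → eval (F i) x) is + 1ℚ                 ≡⟨ cong (λ t → c * foldr _*_ 1ℚ t + 1ℚ) (map-cong eval-F is) ⟩
  c * ∏ℚ (λ i → (x - toℚ (a i)) ^ 6) is + 1ℚ
    ≡⟨ cong (λ t → c * t + 1ℚ) (∏ℚ-^ (λ i → x - toℚ (a i)) 6 is) ⟩
  c * ∏ℚ (λ i → x - toℚ (a i)) is ^ 6 + 1ℚ            ∎
  where
  c : ℚ
  c = toℚ (ℤ.+ (ℓ ℕ.* N ℕ.^ 6))
  is : List (Fin r)
  is = allFin r
  F : Fin r → Poly
  F i = (X -P const (toℚ (a i))) ^P 6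
  eval-F : ∀ i → eval (F i) x ≡ (x - toℚ (a i)) ^ 6
  eval-F i = trans (eval-^P (X -P const (toℚ (a i))) 6 x)
    (cong (_^ 6) (trans (eval-subP X (const (toℚ (a i))) x) (cong₂ _-_ (eval-X x) (eval-const (toℚ (a i)) x))))

eval-fPoly-g≡1 : ∀ h g x → eval g x ≡ 1ℚ → eval (fPoly h g) x ≡ eval h x
eval-fPoly-g≡1 h g x g[x]≡1 =
  trans (eval-fPoly h g x) (trans (cong (λ t → t * ((eval h x - 1ℚ) * t + 1ℚ)) g[x]≡1) (identity (eval h x)))
  where
  identity : ∀ y → 1ℚ * ((y - 1ℚ) * 1ℚ + 1ℚ) ≡ y
  identity = solve-∀ ℚ-ring

h*g≡c*Q^n : ∀ h g c Q n → g ≡ c * Q ^ n + 1ℚ → (h - 1ℚ) * g + 1ℚ ≡ 0ℚ → h * g ≡ c * Q ^ n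
h*g≡c*Q^n h g c Q n g≡ root = begin
  h * g                           ≡⟨ split h g ⟩
  ((h - 1ℚ) * g + 1ℚ) + (g - 1ℚ)  ≡⟨ cong₂ (λ s t → s + (t - 1ℚ)) root g≡ ⟩
  0ℚ + ((c * Q ^ n + 1ℚ) - 1ℚ)    ≡⟨ cancel (c * Q ^ n) ⟩
  c * Q ^ n                       ∎
  where
  split : ∀ h g → h * g ≡ ((h - 1ℚ) * g + 1ℚ) + (g - 1ℚ)
  split = solve-∀ ℚ-ring
  cancel : ∀ y → 0ℚ + ((y + 1ℚ) - 1ℚ) ≡ y
  cancel = solve-∀ ℚ-ring

^-scale : ∀ W Q c n → W ^ n * (c * Q ^ n + 1ℚ) ≡ c * (W * Q) ^ n + W ^ n
^-scale W Q c n = trans (distrib (W ^ n) c (Q ^ n)) (cong (λ t → c * t + W ^ n) (sym (^-distrib-* W Q n)))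
  where
  distrib : ∀ Wn c Qn → Wn * (c * Qn + 1ℚ) ≡ c * (Wn * Qn) + Wn
  distrib = solve-∀ ℚ-ring

^-scale-product : ∀ h g c Q n → h * g ≡ c * Q ^ n → ∀ V m W →
                  (V * (m * h)) * (W ^ n * g) ≡ m * (V * (c * (W * Q) ^ n))
^-scale-product h g c Q n hg≡ V m W = begin
  (V * (m * h)) * (W ^ n * g)      ≡⟨ regroup V m h (W ^ n) g ⟩
  m * (V * (W ^ n * (h * g)))      ≡⟨ cong (λ t → m * (V * (W ^ n * t))) hg≡ ⟩
  m * (V * (W ^ n * (c * Q ^ n)))  ≡⟨ regroup′ m V (W ^ n) c (Q ^ n) ⟩
  m * (V * (c * (W ^ n * Q ^ n)))  ≡⟨ cong (λ t → m * (V * (c * t))) (sym (^-distrib-* W Q n)) ⟩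
  m * (V * (c * (W * Q) ^ n))      ∎
  where
  regroup : ∀ V m h Wn g → (V * (m * h)) * (Wn * g) ≡ m * (V * (Wn * (h * g)))
  regroup = solve-∀ ℚ-ring
  regroup′ : ∀ m V Wn c Qn → m * (V * (Wn * (c * Qn))) ≡ m * (V * (c * (Wn * Qn)))
  regroup′ = solve-∀ ℚ-ring

module AtRationalPoint {r : ℕ} (a : Fin r → ℤ) (ℓ : ℕ) (x : ℚ) where

  m : ℤ
  m = mOf r a

  M N c v : ℕ
  M = ℤ.∣ m ∣
  N = radical M
  c = ℓ ℕ.* N ℕ.^ 6
  v = ℚ.↧ₙ x

  g : Poly
  g = gPoly r a ℓ N

  w Q : ℚ
  w = toℚ (↧ x)
  Q = ∏ℚ (λ i → x - toℚ (a i)) (allFin r)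

  -- P = v ^ r * Q and D = v ^ (6 r) * g (x) are the integers obtained by clearing denominators
  P : ℤ
  P = ∏ℤ (λ i → ↥ x ℤ.- a i ℤ.* ↧ x) (allFin r)

  ∣P∣ D : ℕ
  ∣P∣ = ℤ.∣ P ∣
  D = c ℕ.* ∣P∣ ℕ.^ 6 ℕ.+ v ℕ.^ (r ℕ.* 6)

  g[x]≡ : eval g x ≡ toℚ (ℤ.+ c) * Q ^ 6 + 1ℚ
  g[x]≡ = eval-gPoly r a ℓ N x

  w^r*Q≡P : w ^ r * Q ≡ toℚ P
  w^r*Q≡P = subst (λ n → w ^ n * Q ≡ toℚ P) (length-tabulate {n = r} id) (∏-homogenise x a (allFin r))

  Q≡0⇒x≡aᵢ : Q ≡ 0ℚ → ∃ λ i → x ≡ toℚ (a i)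
  Q≡0⇒x≡aᵢ Q≡0 = Product.map₂ (p-q≡0⇒p≡q x _) (∏ℚ≡0⇒∃≡0 (λ i → x - toℚ (a i)) (allFin r) Q≡0)

  Q≡0⇒g[x]≡1 : Q ≡ 0ℚ → eval g x ≡ 1ℚ
  Q≡0⇒g[x]≡1 Q≡0 = trans g[x]≡ (trans (cong (λ t → toℚ (ℤ.+ c) * t ^ 6 + 1ℚ) Q≡0)
                                     (cong (_+ 1ℚ) (ℚP.*-zeroʳ (toℚ (ℤ.+ c)))))

  Q≢0⇒∣P∣≢0 : Q ≢ 0ℚ → NonZero ∣P∣
  Q≢0⇒∣P∣≢0 Q≢0 = ℕ.≢-nonZero (P≢0 ∘ ℤP.∣i∣≡0⇒i≡0)
    where
    w≢0 : w ≢ 0ℚ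
    w≢0 w≡0 = case ℤP.+-injective (toℚ-injective {↧ x} {ℤ.0ℤ} w≡0) of λ ()
    P≢0 : P ≢ ℤ.0ℤ
    P≢0 P≡0 with p*q≡0⇒p≡0∨q≡0 (w ^ r) Q (trans w^r*Q≡P (cong toℚ P≡0))
    ... | inj₁ w^r≡0 = ^≢0 w r w≢0 w^r≡0
    ... | inj₂ Q≡0   = Q≢0 Q≡0

  private
    +cP⁶≡ : ℤ.+ (c ℕ.* ∣P∣ ℕ.^ 6) ≡ ℤ.+ c ℤ.* P ℤ.^ 6
    +cP⁶≡ = trans (ℤP.pos-* c _) (cong (ℤ.+ c ℤ.*_) (sym (^-even P 3)))

    toℚ[cP⁶] : toℚ (ℤ.+ c ℤ.* P ℤ.^ 6) ≡ toℚ (ℤ.+ c) * toℚ P ^ 6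
    toℚ[cP⁶] = trans (toℚ-homo-* (ℤ.+ c) (P ℤ.^ 6)) (cong (toℚ (ℤ.+ c) *_) (toℚ-homo-^ P 6))

  w^[6r]*g[x]≡D : (w ^ r) ^ 6 * eval g x ≡ toℚ (ℤ.+ D)
  w^[6r]*g[x]≡D = begin
    (w ^ r) ^ 6 * eval g x                     ≡⟨ cong ((w ^ r) ^ 6 *_) g[x]≡ ⟩
    (w ^ r) ^ 6 * (toℚ (ℤ.+ c) * Q ^ 6 + 1ℚ)   ≡⟨ ^-scale (w ^ r) Q (toℚ (ℤ.+ c)) 6 ⟩
    toℚ (ℤ.+ c) * (w ^ r * Q) ^ 6 + (w ^ r) ^ 6
      ≡⟨ cong₂ (λ s t → toℚ (ℤ.+ c) * s ^ 6 + t) w^r*Q≡P (^-assocʳ w r 6) ⟩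
    toℚ (ℤ.+ c) * toℚ P ^ 6 + w ^ (r ℕ.* 6)
      ≡⟨ sym (cong₂ _+_ toℚ[cP⁶] (toℚ-homo-^ (↧ x) (r ℕ.* 6))) ⟩
    toℚ (ℤ.+ c ℤ.* P ℤ.^ 6) + toℚ (↧ x ℤ.^ (r ℕ.* 6))
      ≡⟨ sym (toℚ-homo-+ (ℤ.+ c ℤ.* P ℤ.^ 6) (↧ x ℤ.^ (r ℕ.* 6))) ⟩
    toℚ (ℤ.+ c ℤ.* P ℤ.^ 6 ℤ.+ ↧ x ℤ.^ (r ℕ.* 6))
      ≡⟨ cong toℚ (sym (trans (ℤP.pos-+ (c ℕ.* ∣P∣ ℕ.^ 6) (v ℕ.^ (r ℕ.* 6)))
                              (cong₂ ℤ._+_ +cP⁶≡ (sym (pos-^ v (r ℕ.* 6)))))) ⟩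
    toℚ (ℤ.+ D)                                ∎

  g[x]≢0 : eval g x ≢ 0ℚ
  g[x]≢0 g[x]≡0 = case ℕP.m^n≡0⇒m≡0 v (r ℕ.* 6) (ℕP.m+n≡0⇒n≡0 (c ℕ.* ∣P∣ ℕ.^ 6) D≡0) of λ ()
    where
    D≡0 : D ≡ 0
    D≡0 = ℤP.+-injective (toℚ-injective {ℤ.+ D} {ℤ.0ℤ}
            (trans (sym w^[6r]*g[x]≡D) (trans (cong ((w ^ r) ^ 6 *_) g[x]≡0) (ℚP.*-zeroʳ ((w ^ r) ^ 6)))))

  root⇒h[x]*g[x]≡ : ∀ h → eval (fPoly h g) x ≡ 0ℚ → eval h x * eval g x ≡ toℚ (ℤ.+ c) * Q ^ 6
  root⇒h[x]*g[x]≡ h f[x]≡0 = h*g≡c*Q^n (eval h x) (eval g x) (toℚ (ℤ.+ c)) Q 6 g[x]≡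
    (*-cancelˡ-≡0 (eval g x) _ g[x]≢0 (trans (sym (eval-fPoly h g x)) f[x]≡0))

  root⇒D∣M*[v^K*[c*∣P∣^6]] : ∀ h K → eval (fPoly h g) x ≡ 0ℚ →
                               IntegralPoly (toℚ m ·P h) → HasDegree h K →
                               D ℕ∣.∣ M ℕ.* (v ℕ.^ K ℕ.* (c ℕ.* ∣P∣ ℕ.^ 6))
  root⇒D∣M*[v^K*[c*∣P∣^6]] h K f[x]≡0 m·h-integral deg-h = divides ℤ.∣ H ∣ (sym ∣H∣D≡ME)
    where
    cleared : ∃ λ H → w ^ K * eval (toℚ m ·P h) x ≡ toℚ H
    cleared = eval-clearDenominators x (toℚ m ·P h) K m·h-integral (coeff-·P-above-degree (toℚ m) {h} deg-h)

    H : ℤ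
    H = proj₁ cleared

    w^K*m*h[x]≡H : w ^ K * (toℚ m * eval h x) ≡ toℚ H
    w^K*m*h[x]≡H = trans (cong (w ^ K *_) (sym (eval-·P (toℚ m) h x))) (proj₂ cleared)

    E : ℕ
    E = v ℕ.^ K ℕ.* (c ℕ.* ∣P∣ ℕ.^ 6)

    HD≡mE : H ℤ.* ℤ.+ D ≡ m ℤ.* ℤ.+ E
    HD≡mE = toℚ-injective (begin
      toℚ (H ℤ.* ℤ.+ D)                                     ≡⟨ toℚ-homo-* H (ℤ.+ D) ⟩
      toℚ H * toℚ (ℤ.+ D)                                   ≡⟨ sym (cong₂ _*_ w^K*m*h[x]≡H w^[6r]*g[x]≡D) ⟩
      (w ^ K * (toℚ m * eval h x)) * ((w ^ r) ^ 6 * eval g x)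
        ≡⟨ ^-scale-product (eval h x) (eval g x) (toℚ (ℤ.+ c)) Q 6 (root⇒h[x]*g[x]≡ h f[x]≡0) (w ^ K) (toℚ m) (w ^ r) ⟩
      toℚ m * (w ^ K * (toℚ (ℤ.+ c) * (w ^ r * Q) ^ 6))
        ≡⟨ cong (λ t → toℚ m * (w ^ K * (toℚ (ℤ.+ c) * t ^ 6))) w^r*Q≡P ⟩
      toℚ m * (w ^ K * (toℚ (ℤ.+ c) * toℚ P ^ 6))
        ≡⟨ sym (cong (toℚ m *_) (trans (toℚ-homo-* (↧ x ℤ.^ K) (ℤ.+ c ℤ.* P ℤ.^ 6))
                                       (cong₂ _*_ (toℚ-homo-^ (↧ x) K) toℚ[cP⁶]))) ⟩
      toℚ m * toℚ (↧ x ℤ.^ K ℤ.* (ℤ.+ c ℤ.* P ℤ.^ 6))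
        ≡⟨ sym (toℚ-homo-* m (↧ x ℤ.^ K ℤ.* (ℤ.+ c ℤ.* P ℤ.^ 6))) ⟩
      toℚ (m ℤ.* (↧ x ℤ.^ K ℤ.* (ℤ.+ c ℤ.* P ℤ.^ 6)))
        ≡⟨ cong (λ t → toℚ (m ℤ.* t)) (sym (trans (ℤP.pos-* (v ℕ.^ K) _) (cong₂ ℤ._*_ (sym (pos-^ v K)) +cP⁶≡))) ⟩
      toℚ (m ℤ.* ℤ.+ E)                                     ∎)

    ∣H∣D≡ME : ℤ.∣ H ∣ ℕ.* D ≡ M ℕ.* E
    ∣H∣D≡ME = trans (sym (ℤP.abs-* H (ℤ.+ D))) (trans (cong ℤ.∣_∣ HD≡mE) (ℤP.abs-* m (ℤ.+ E)))

  prime∣v⇒∤∣P∣ : ∀ {p} → Prime p → p ℕ∣.∣ v → ¬ p ℕ∣.∣ ∣P∣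
  prime∣v⇒∤∣P∣ pp p∣v p∣P with prime∣∏ℤ⇒∣factor pp (λ i → ↥ x ℤ.- a i ℤ.* ↧ x) (allFin r) p∣P
  ... | i , p∣u-aᵢv = ¬prime[1] (subst Prime
    (↥-↧-coprime x (∣u-a*v∣∧∣v⇒∣u (↥ x) (a i) (↧ x) p∣u-aᵢv p∣v , p∣v)) pp)

  M≢0 : Injective _≡_ _≡_ a → NonZero M
  M≢0 a-injective = ℕ.≢-nonZero (mOf≢0 r a a-injective ∘ ℤP.∣i∣≡0⇒i≡0)

  prime∣M⇒∣c : .{{NonZero M}} → ∀ {p} → Prime p → p ℕ∣.∣ M → p ℕ∣.∣ c
  prime∣M⇒∣c pp p∣M = ℕ∣.∣n⇒∣m*n ℓ (ℕ∣.∣m⇒∣m*n (N ℕ.^ 5) (prime∣⇒prime∣radical M pp p∣M))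

  c≢0 : Prime ℓ → NonZero c
  c≢0 ℓ-prime = ℕP.m*n≢0 ℓ (N ℕ.^ 6) {{prime⇒nonZero ℓ-prime}} {{ℕP.m^n≢0 N 6 {{radical≢0 M}}}}

  ¬p^8∣c : Prime ℓ → ∀ {p} → Prime p → ¬ p ℕ.^ 8 ℕ∣.∣ c
  ¬p^8∣c ℓ-prime pp = ¬prime^[2+k]∣m*n^k (prime⇒squareFree ℓ-prime) (radical-squareFree M) pp 6

lemma5p3 : {c ℓ' : Level} (r : ℕ) → 2 ℕ.≤ r →
    (a b : Fin r → ℤ) →
    Injective _≡_ _≡_ a →
    (∀ i → ¬ (a i ≡ ℤ.0ℤ)) →
    (∀ i → ¬ (b i ≡ ℤ.0ℤ)) →
    (h : Poly) →
    Irreducible h →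
    HasDegree h (6 ℕ.* r ℕ.+ 3) →
    (∀ i → eval h (a i ℚ./ 1) ≡ (b i ℤ.^ (18 ℕ.* r ℕ.+ 3)) ℚ./ 1) →
    IntegralPoly ((mOf r a ℚ./ 1) ·P h) →
    (C : CommutativeRing c ℓ') →
    (ι : ℚ → CommutativeRing.Carrier C) →
    IsRingHomomorphism ℚ.+-*-rawRing (CommutativeRing.rawRing C) ι →
    (B : List (CommutativeRing.Carrier C)) →
    (ℓ : ℕ) → Prime ℓ →
    (∀ z → z ∈ B →
      ¬ (CommutativeRing._≈_ C (evalIn C ι (gPoly r a ℓ (radical (ℤ.∣ mOf r a ∣))) z) (CommutativeRing.0# C))) →
    Separable (((h -P const ℚ.1ℚ) *P gPoly r a ℓ (radical (ℤ.∣ mOf r a ∣))) +P const ℚ.1ℚ) →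
    gcd ℓ (radical (ℤ.∣ mOf r a ∣)) ≡ 1 →
    ℓ % 12 ≡ 5 →
    (x : ℚ) → ¬ (eval (fPoly h (gPoly r a ℓ (radical (ℤ.∣ mOf r a ∣)))) x ≡ 0ℚ)
lemma5p3 r 2≤r a b a-injective _ b≢0 h _ deg-h h[aᵢ] m·h-integral _ _ _ _ ℓ ℓ-prime _ _ _ _ x f[x]≡0 =
  case Q ℚP.≟ 0ℚ of λ where
    (yes Q≡0) → at-node Q≡0
    (no  Q≢0) → c*P^e+v^n∤M*[v^K*[c*P^e]] 6 (r ℕ.* 6) (6 ℕ.* r ℕ.+ 3)
                  {{c≢0 ℓ-prime}} {{Q≢0⇒∣P∣≢0 Q≢0}}
                  (prime∣M⇒∣c {{M≢0 a-injective}}) prime∣v⇒∤∣P∣ (¬p^8∣c ℓ-prime) 8≤6r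
                  (root⇒D∣M*[v^K*[c*∣P∣^6]] h (6 ℕ.* r ℕ.+ 3) f[x]≡0 m·h-integral deg-h)
  where
  open AtRationalPoint a ℓ x

  at-node : Q ≡ 0ℚ → ⊥
  at-node Q≡0 with Q≡0⇒x≡aᵢ Q≡0
  ... | i , x≡aᵢ = b≢0 i (ℤP.i^n≡0⇒i≡0 (b i) (18 ℕ.* r ℕ.+ 3) (toℚ-injective (begin
    toℚ (b i ℤ.^ (18 ℕ.* r ℕ.+ 3)) ≡⟨ sym (h[aᵢ] i) ⟩
    eval h (toℚ (a i))             ≡⟨ cong (eval h) (sym x≡aᵢ) ⟩
    eval h x                       ≡⟨ sym (eval-fPoly-g≡1 h g x (Q≡0⇒g[x]≡1 Q≡0)) ⟩
    eval (fPoly h g) x             ≡⟨ f[x]≡0 ⟩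
    0ℚ                             ∎)))

  8≤6r : 8 ℕ.≤ r ℕ.* 6
  8≤6r = ℕP.≤-trans (ℕP.m≤m+n 8 4) (ℕP.*-monoˡ-≤ 6 2≤r)
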